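{- Let $\Gamma=(\mathcal{P},\mathcal{L},\mathtt{I})$ be a finite weak generalised $2m$-gon of order $(s,t)$, $m\ge2$. Let $B$ be a set of points such that every line contains at least one point of $B$. Then $|B|\ge \frac{s^mt^m-1}{st-1}$.
   Context: A weak generalised $n$-gon ($n\ge3$) is a point-line geometry (points, lines, symmetric incidence; elements are points or lines) with no ordinary $k$-gon as subgeometry for $2\le k<n$ and in which any two elements lie in a common ordinary $n$-gon. Order $(s,t)$, $s,t\ge1$: each line has exactly $s+1$ points, each point is on exactly $t+1$ lines. -}

module Defs where

open import Data.Nat using (ℕ; zero; suc; _+_; _*_; _<_; _≤_)
open import Data.Fin using (Fin)
open import Data.Fin.Subset using (Subset)
open import Data.Bool using (Bool; true)
open import Data.Sum using (_⊎_; inj₁; inj₂)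
open import Data.Product using (_×_; ∃; ∃-syntax; Σ; _,_)
open import Data.Vec using (tabulate)
open import Data.Empty using (⊥)
open import Relation.Nullary using (¬_)
open import Relation.Binary.PropositionalEquality using (_≡_)

record Geometry : Set where
  field
    np  : ℕ
    nl  : ℕ
    inc : Fin np → Fin nl → Bool

module _ (Γ : Geometry) where
  open Geometry Γ

  Elem : Set
  Elem = Fin np ⊎ Fin nl

  _I_ : Elem → Elem → Set
  inj₁ p I inj₂ L = inc p L ≡ true
  inj₂ L I inj₁ p = inc p L ≡ true
  inj₁ _ I inj₁ _ = ⊥
  inj₂ _ I inj₂ _ = ⊥

  -- Points and lines alternate automatically.
  IsOrdinaryGon : ℕ → (ℕ → Elem) → Set
  IsOrdinaryGon k f =
      (∀ i → i < k + k → f i I f (suc i))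
    × (f (k + k) ≡ f 0)
    × (∀ i j → i < k + k → j < k + k → f i ≡ f j → i ≡ j)

  HasOrdinaryGon : ℕ → Set
  HasOrdinaryGon k = ∃[ f ] IsOrdinaryGon k f

  record IsWeakGenPolygon (n : ℕ) : Set where
    field
      n≥3        : 3 ≤ n
      nonempty   : 1 ≤ np
      noSmallGon : ∀ k → 2 ≤ k → k < n → ¬ HasOrdinaryGon k
      commonGon  : ∀ (x y : Elem) →
                   ∃[ f ] (IsOrdinaryGon n f
                     × (∃[ i ] (i < n + n × f i ≡ x))
                     × (∃[ j ] (j < n + n × f j ≡ y)))

  pointsOn : Fin nl → Subset np
  pointsOn L = tabulate (λ p → inc p L)

  linesThrough : Fin np → Subset nl
  linesThrough p = tabulate (λ L → inc p L)

  record HasOrder (s t : ℕ) : Set where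
    field
      s≥1     : 1 ≤ s
      t≥1     : 1 ≤ t
      lineSize  : ∀ L → Data.Fin.Subset.∣ pointsOn L ∣ ≡ suc s
      pointDeg  : ∀ p → Data.Fin.Subset.∣ linesThrough p ∣ ≡ suc t

  Blocks : Subset np → Set
  Blocks B = ∀ L → ∃[ p ] (p Data.Fin.Subset.∈ B × inc p L ≡ true)

-- In the incidence graph, a closed non-backtracking walk of positive length l contains an
-- ordinary k-gon with 2k ≤ l: the stretch between the first repeated element and its earlier
-- occurrence is a cycle, of even length since points and lines alternate, and of length ≠ 2
-- since the walk does not backtrack. As Γ has no ordinary k-gon with k < 2m, such walks have
-- length ≥ 4m, so distinct non-backtracking walks of lengths < 2m from a fixed point p₀ end
-- at distinct elements. There are (t+1)(st)^i such walks of length 2i+1, all ending at lines,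
-- so there are at least (t+1)(1 + st + ⋯ + (st)^(m-1)) lines. As B meets every line and every
-- point is on t+1 lines, there are at most |B|(t+1) lines, whence |B| ≥ ((st)^m - 1)/(st - 1).

module Submission where

open import Defs
open import Data.Nat using (ℕ; _+_; _*_; _∸_; _^_; _≤_)
open import Data.Fin.Subset using (Subset; ∣_∣)

open import Data.Bool using (Bool; true; false; not)
open import Data.Bool.Properties using (not-¬; not-involutive)
open import Data.Empty using (⊥; ⊥-elim)
open import Data.Fin using (Fin; zero; suc; fromℕ<)
import Data.Fin.Properties as Fin
import Data.Fin.Subset as Subset
open import Data.List
  using (List; []; _∷_; [_]; _++_; map; concatMap; filter; length; allFin; _ʳ++_; head; drop)
open import Data.List.Membership.Propositional using (_∈_; find; lose)
open import Data.List.Membership.Propositional.Properties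
  using (∈-map⁺; ∈-map⁻; ∈-++⁺ˡ; ∈-++⁺ʳ; ∈-++⁻; ∈-∃++; ∈-concatMap⁺; ∈-concatMap⁻; ∈-allFin;
         ∈-filter⁻)
open import Data.List.Properties
  using (∷-injectiveˡ; drop-drop; length-map; length-++; length-ʳ++; length-tabulate;
         filter-accept; filter-reject; filter-all)
open import Data.List.Relation.Binary.Subset.Propositional using (_⊆_)
open import Data.List.Relation.Unary.All as All using (All; []; _∷_)
import Data.List.Relation.Unary.All.Properties as AllP
open import Data.List.Relation.Unary.AllPairs using ([]; _∷_)
open import Data.List.Relation.Unary.Any using (here; there)
open import Data.List.Relation.Unary.Unique.Propositional using (Unique)
import Data.List.Relation.Unary.Unique.Propositional.Properties as Unique
open import Data.Maybe using (just)
open import Data.Nat using (zero; suc; _<_; z≤n; s≤s)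
open import Data.Nat.Properties
open import Data.Product using (_×_; _,_; ∃-syntax; ∃₂)
open import Data.Sum using (_⊎_; inj₁; inj₂)
import Data.Sum.Properties as Sum
open import Data.Unit using (⊤)
open import Data.Vec using ([]; _∷_; tabulate; here; there)
open import Data.Vec.Properties using (lookup∘tabulate; []=⇒lookup; lookup⇒[]=)
open import Function using (_∘_; _$_; id)
open import Relation.Binary.Definitions using (DecidableEquality)
open import Relation.Binary.PropositionalEquality
  using (_≡_; _≢_; refl; sym; trans; cong; cong₂; subst; subst₂; module ≡-Reasoning)
open import Relation.Nullary using (¬_; ¬?; yes; no; contradiction)

geometricSum : ℕ → ℕ → ℕ
geometricSum a zero    = 0
geometricSum a (suc n) = a ^ n + geometricSum a n

geometricSum-closedForm : ∀ b n → geometricSum (suc b) n * b + 1 ≡ suc b ^ n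
geometricSum-closedForm b zero    = refl
geometricSum-closedForm b (suc n) = begin
  (a ^ n + geometricSum a n) * b + 1     ≡⟨ cong (_+ 1) (*-distribʳ-+ b (a ^ n) (geometricSum a n)) ⟩
  a ^ n * b + geometricSum a n * b + 1   ≡⟨ +-assoc (a ^ n * b) _ 1 ⟩
  a ^ n * b + (geometricSum a n * b + 1) ≡⟨ cong (a ^ n * b +_) (geometricSum-closedForm b n) ⟩
  a ^ n * b + a ^ n                      ≡⟨ +-comm (a ^ n * b) (a ^ n) ⟩
  a ^ n + a ^ n * b                      ≡⟨ cong (a ^ n +_) (*-comm (a ^ n) b) ⟩
  a ^ n + b * a ^ n                      ∎
  where open ≡-Reasoning
        a = suc b

geometricSum≤⇒^∸1≤ : ∀ a n x → 1 ≤ a → geometricSum a n ≤ x →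
  a ^ n ∸ 1 ≤ x * (a ∸ 1)
geometricSum≤⇒^∸1≤ (suc b) n x _ sum≤x = begin
  suc b ^ n ∸ 1                         ≡⟨ cong (_∸ 1) (geometricSum-closedForm b n) ⟨
  geometricSum (suc b) n * b + 1 ∸ 1    ≡⟨ m+n∸n≡m _ 1 ⟩
  geometricSum (suc b) n * b            ≤⟨ *-monoˡ-≤ b sum≤x ⟩
  x * b                                 ∎
  where open ≤-Reasoning

module _ {A : Set} where

  ∈-++-∷⁻ : ∀ {x z : A} ys zs → z ∈ ys ++ x ∷ zs → z ≢ x → z ∈ ys ++ zs
  ∈-++-∷⁻ ys zs z∈ z≢x with ∈-++⁻ ys z∈
  ... | inj₁ z∈ys         = ∈-++⁺ˡ z∈ys
  ... | inj₂ (here z≡x)   = contradiction z≡x z≢x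
  ... | inj₂ (there z∈zs) = ∈-++⁺ʳ ys z∈zs

  Unique-⊆⇒length≤ : ∀ {xs ys : List A} → Unique xs → xs ⊆ ys → length xs ≤ length ys
  Unique-⊆⇒length≤ {[]}     _            _     = z≤n
  Unique-⊆⇒length≤ {x ∷ xs} (x∉xs ∷ !xs) xs⊆ys with ∈-∃++ (xs⊆ys (here refl))
  ... | ys , zs , refl = begin
    suc (length xs)           ≤⟨ s≤s (Unique-⊆⇒length≤ !xs xs⊆ys++zs) ⟩
    suc (length (ys ++ zs))   ≡⟨ cong suc (length-++ ys) ⟩
    suc (length ys + length zs) ≡⟨ +-suc (length ys) (length zs) ⟨
    length ys + length (x ∷ zs) ≡⟨ length-++ ys ⟨
    length (ys ++ x ∷ zs)     ∎
    where
      open ≤-Reasoning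
      xs⊆ys++zs : xs ⊆ ys ++ zs
      xs⊆ys++zs z∈xs =
        ∈-++-∷⁻ ys zs (xs⊆ys (there z∈xs)) λ z≡x → All.lookup x∉xs z∈xs (sym z≡x)

  Unique-map⁺-injectiveOn : ∀ {B : Set} {P : A → Set} {f : A → B} {xs} →
    (∀ {x y} → P x → P y → f x ≡ f y → x ≡ y) → All P xs → Unique xs → Unique (map f xs)
  Unique-map⁺-injectiveOn inj []         []            = []
  Unique-map⁺-injectiveOn inj (px ∷ pxs) (x∉xs ∷ !xs) =
    AllP.map⁺ (All.zipWith (λ (x≢y , py) fx≡fy → x≢y (inj px py fx≡fy)) (x∉xs , pxs))
    ∷ Unique-map⁺-injectiveOn inj pxs !xs

  module _ {B : Set} (f : A → List B) where

    length-concatMap-uniform : ∀ {c} xs → All (λ x → length (f x) ≡ c) xs →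
      length (concatMap f xs) ≡ length xs * c
    length-concatMap-uniform []       []         = refl
    length-concatMap-uniform (x ∷ xs) (fx≡c ∷ h) =
      trans (length-++ (f x)) (cong₂ _+_ fx≡c (length-concatMap-uniform xs h))

    Unique-concatMap : (g : B → A) → (∀ x {y} → y ∈ f x → g y ≡ x) →
      (∀ x → Unique (f x)) → ∀ {xs} → Unique xs → Unique (concatMap f xs)
    Unique-concatMap g g-inv !f {[]}     []            = []
    Unique-concatMap g g-inv !f {x ∷ xs} (x∉xs ∷ !xs) =
      Unique.++⁺ (!f x) (Unique-concatMap g g-inv !f !xs) disjoint
      where
        disjoint : ∀ {y} → ¬ (y ∈ f x × y ∈ concatMap f xs)
        disjoint (y∈fx , y∈rest) with find (∈-concatMap⁻ f y∈rest)
        ... | x′ , x′∈xs , y∈fx′ =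
          All.lookup x∉xs x′∈xs (trans (sym (g-inv x y∈fx)) (g-inv x′ y∈fx′))

  module _ (_≟_ : DecidableEquality A) where

    length-filter-≢ : ∀ {x xs} → Unique xs → x ∈ xs →
      suc (length (filter (¬? ∘ (_≟ x)) xs)) ≡ length xs
    length-filter-≢ {x} {.x ∷ xs} (x∉xs ∷ _) (here refl)
      rewrite filter-reject (¬? ∘ (_≟ x)) {x} {xs} (λ x≢x → x≢x refl)
            | filter-all (¬? ∘ (_≟ x)) (All.map (λ x≢y y≡x → x≢y (sym y≡x)) x∉xs) = refl
    length-filter-≢ {x} {y ∷ xs} (y∉xs ∷ !xs) (there x∈xs)
      rewrite filter-accept (¬? ∘ (_≟ x)) {y} {xs} (All.lookup y∉xs x∈xs) =
        cong suc (length-filter-≢ !xs x∈xs)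

elements : ∀ {n} → Subset n → List (Fin n)
elements []          = []
elements (true ∷ p)  = zero ∷ map suc (elements p)
elements (false ∷ p) = map suc (elements p)

length-elements : ∀ {n} (p : Subset n) → length (elements p) ≡ ∣ p ∣
length-elements []          = refl
length-elements (true ∷ p)  = cong suc (trans (length-map suc (elements p)) (length-elements p))
length-elements (false ∷ p) = trans (length-map suc (elements p)) (length-elements p)

∈-elements⁺ : ∀ {n} {p : Subset n} {i} → i Subset.∈ p → i ∈ elements p
∈-elements⁺ {p = true ∷ p}  here          = here refl
∈-elements⁺ {p = true ∷ p}  (there i∈p)   = there (∈-map⁺ suc (∈-elements⁺ i∈p))
∈-elements⁺ {p = false ∷ p} (there i∈p)   = ∈-map⁺ suc (∈-elements⁺ i∈p)

∈-elements⁻ : ∀ {n} {p : Subset n} {i} → i ∈ elements p → i Subset.∈ p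
∈-elements⁻ {p = true ∷ p}  (here refl) = here
∈-elements⁻ {p = true ∷ p}  (there i∈)  with ∈-map⁻ suc i∈
... | j , j∈ , refl = there (∈-elements⁻ j∈)
∈-elements⁻ {p = false ∷ p} i∈          with ∈-map⁻ suc i∈
... | j , j∈ , refl = there (∈-elements⁻ j∈)

Unique-elements : ∀ {n} (p : Subset n) → Unique (elements p)
Unique-elements []          = []
Unique-elements (true ∷ p)  =
  AllP.map⁺ (All.universal (λ _ ()) _) ∷ Unique.map⁺ Fin.suc-injective (Unique-elements p)
Unique-elements (false ∷ p) = Unique.map⁺ Fin.suc-injective (Unique-elements p)

∈-tabulate⁺ : ∀ {n} {f : Fin n → Bool} {i} → f i ≡ true → i Subset.∈ tabulate f
∈-tabulate⁺ {f = f} {i} fi≡true = lookup⇒[]= i (tabulate f) (trans (lookup∘tabulate f i) fi≡true)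

∈-tabulate⁻ : ∀ {n} {f : Fin n → Bool} {i} → i Subset.∈ tabulate f → f i ≡ true
∈-tabulate⁻ {f = f} {i} i∈ = trans (sym (lookup∘tabulate f i)) ([]=⇒lookup i∈)

alternating-return⇒even : ∀ (b : ℕ → Bool) l → (∀ i → i < l → b (suc i) ≡ not (b i)) →
  b l ≡ b 0 → ∃[ k ] k + k ≡ l
alternating-return⇒even b zero                alt return = 0 , refl
alternating-return⇒even b (suc zero)          alt return =
  contradiction (trans (sym return) (alt 0 (s≤s z≤n))) (not-¬ refl)
alternating-return⇒even b (suc (suc l)) alt return =
  let k , k+k≡l = alternating-return⇒even (λ i → b (2 + i)) l (λ i i<l → alt (2 + i) (s≤s (s≤s i<l)))
                                          (trans return (sym b₂≡b₀))
  in suc k , cong suc (trans (+-suc k k) (cong suc k+k≡l))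
  where
    b₂≡b₀ : b 2 ≡ b 0
    b₂≡b₀ = begin
      b 2             ≡⟨ alt 1 (s≤s (s≤s z≤n)) ⟩
      not (b 1)       ≡⟨ cong not (alt 0 (s≤s z≤n)) ⟩
      not (not (b 0)) ≡⟨ not-involutive (b 0) ⟩
      b 0             ∎
      where open ≡-Reasoning

module _ {A : Set} where

  InjectiveBelow : (ℕ → A) → ℕ → Set
  InjectiveBelow w l = ∀ i j → i < l → j < l → w i ≡ w j → i ≡ j

  InjectiveBelow-drop : ∀ {w} i {d} → InjectiveBelow w (i + d) → InjectiveBelow (λ n → w (i + n)) d
  InjectiveBelow-drop i inj a b a<d b<d wa≡wb =
    +-cancelˡ-≡ i a b (inj (i + a) (i + b) (+-monoʳ-< i a<d) (+-monoʳ-< i b<d) wa≡wb)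

  firstRepetition : DecidableEquality A → ∀ (w : ℕ → A) l →
    InjectiveBelow w l ⊎ ∃₂ λ i j → i < j × j < l × w i ≡ w j × InjectiveBelow w j
  firstRepetition _≟_ w zero    = inj₁ λ _ _ ()
  firstRepetition _≟_ w (suc l) with firstRepetition _≟_ w l
  ... | inj₂ (i , j , i<j , j<l , wi≡wj , inj) = inj₂ (i , j , i<j , m<n⇒m<1+n j<l , wi≡wj , inj)
  ... | inj₁ inj with anyUpTo? (λ i → w i ≟ w l) l
  ...   | yes (i , i<l , wi≡wl) = inj₂ (i , l , i<l , ≤-refl , wi≡wl , inj)
  ...   | no wl-new             = inj₁ inj′
    where
      inj′ : InjectiveBelow w (suc l)
      inj′ i j i<1+l j<1+l wi≡wj with m<1+n⇒m<n∨m≡n i<1+l | m<1+n⇒m<n∨m≡n j<1+l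
      ... | inj₁ i<l  | inj₁ j<l  = inj i j i<l j<l wi≡wj
      ... | inj₁ i<l  | inj₂ refl = contradiction (i , i<l , wi≡wj) wl-new
      ... | inj₂ refl | inj₁ j<l  = contradiction (j , j<l , sym wi≡wj) wl-new
      ... | inj₂ refl | inj₂ refl = refl

module Walks {A : Set} (_~_ : A → A → Set) (~-sym : ∀ {x y} → x ~ y → y ~ x) where

  IsWalk : (ℕ → A) → ℕ → Set
  IsWalk w l = ∀ i → i < l → w i ~ w (suc i)

  IsNonBacktracking : (ℕ → A) → ℕ → Set
  IsNonBacktracking w l = ∀ i → suc i < l → w i ≢ w (suc (suc i))

  IsNBWalk : (ℕ → A) → ℕ → Set
  IsNBWalk w l = IsWalk w l × IsNonBacktracking w l

  IsNBWalk-≤ : ∀ {w d l} → d ≤ l → IsNBWalk w l → IsNBWalk w d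
  IsNBWalk-≤ d≤l (walk , nb) =
    (λ i i<d → walk i (≤-trans i<d d≤l)) , (λ i i<d → nb i (≤-trans i<d d≤l))

  IsNBWalk-drop : ∀ {w} i {d} → IsNBWalk w (i + d) → IsNBWalk (λ n → w (i + n)) d
  IsNBWalk-drop zero    nbw          = nbw
  IsNBWalk-drop (suc i) (walk , nb) =
    IsNBWalk-drop i ((λ n n< → walk (suc n) (s≤s n<)) , (λ n n< → nb (suc n) (s≤s n<)))

  _≢head_ : A → List A → Set
  x ≢head []      = ⊤
  x ≢head (y ∷ _) = x ≢ y

  -- A non-backtracking walk listed from its last vertex back to its first.
  data NBWalkʳ : List A → Set where
    start : ∀ x → NBWalkʳ [ x ]
    step  : ∀ {x y ws} → x ~ y → x ≢head ws → NBWalkʳ (y ∷ ws) → NBWalkʳ (x ∷ y ∷ ws)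

  NBWalkʳ-tail : ∀ {x y ws} → NBWalkʳ (x ∷ y ∷ ws) → NBWalkʳ (y ∷ ws)
  NBWalkʳ-tail (step _ _ w) = w

  data LastIs (p : A) : List A → Set where
    last : LastIs p [ p ]
    _∷_  : ∀ x {xs} → LastIs p xs → LastIs p (x ∷ xs)

  at : A → List A → ℕ → A
  at x _        zero    = x
  at x []       (suc i) = x
  at x (y ∷ ys) (suc i) = at y ys i

  NBWalkʳ⇒IsNBWalk : ∀ {x xs} → NBWalkʳ (x ∷ xs) → IsNBWalk (at x xs) (length xs)
  NBWalkʳ⇒IsNBWalk w = walk w , nonBacktracking w
    where
      walk : ∀ {x xs} → NBWalkʳ (x ∷ xs) → IsWalk (at x xs) (length xs)
      walk (step x~y _ _) zero    _         = x~y
      walk (step _ _ w)   (suc i) (s≤s i<l) = walk w i i<l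
      nonBacktracking : ∀ {x xs} → NBWalkʳ (x ∷ xs) → IsNonBacktracking (at x xs) (length xs)
      nonBacktracking (step _ x≢z (step _ _ _)) zero    _         = x≢z
      nonBacktracking (step _ _ w)              (suc i) (s≤s i<l) = nonBacktracking w i i<l

  at-LastIs : ∀ {p x xs} → LastIs p (x ∷ xs) → at x xs (length xs) ≡ p
  at-LastIs                  last     = refl
  at-LastIs {xs = _ ∷ _} (_ ∷ ps) = at-LastIs ps

  ʳ++-NBWalkʳ : ∀ {a x xs acc} → NBWalkʳ (a ∷ x ∷ xs) → x ≢head acc → NBWalkʳ (a ∷ acc) →
    NBWalkʳ ((x ∷ xs) ʳ++ (a ∷ acc))
  ʳ++-NBWalkʳ {xs = []}     (step a~x _ _)     x≢acc w = step (~-sym a~x) x≢acc w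
  ʳ++-NBWalkʳ {xs = _ ∷ _} (step a~x a≢x′ w′) x≢acc w =
    ʳ++-NBWalkʳ w′ (λ x′≡a → a≢x′ (sym x′≡a)) (step (~-sym a~x) x≢acc w)

  ʳ++-LastIs : ∀ {p} xs {acc} → LastIs p acc → LastIs p (xs ʳ++ acc)
  ʳ++-LastIs []       ps = ps
  ʳ++-LastIs (x ∷ xs) ps = ʳ++-LastIs xs (x ∷ ps)

  ʳ++-head : ∀ {p x xs} acc → LastIs p (x ∷ xs) → ∃[ ys ] (x ∷ xs) ʳ++ acc ≡ p ∷ ys
  ʳ++-head                  acc last     = acc , refl
  ʳ++-head {xs = _ ∷ _} acc (x ∷ ps) = ʳ++-head (x ∷ acc) ps

  module _ (_≟_ : DecidableEquality A) {g : ℕ}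
           (noShortCycle : ∀ {w l} → IsNBWalk w l → 0 < l → l < g → w l ≡ w 0 → ⊥) {p : A} where

    noShortClosedNBWalkʳ : ∀ {ys} → NBWalkʳ (p ∷ ys) → LastIs p (p ∷ ys) →
      0 < length ys → length ys < g → ⊥
    noShortClosedNBWalkʳ w ps 0<l l<g = noShortCycle (NBWalkʳ⇒IsNBWalk w) 0<l l<g (at-LastIs ps)

    NBWalkʳ-unique : ∀ {h u v} → NBWalkʳ (h ∷ u) → NBWalkʳ (h ∷ v) →
      LastIs p (h ∷ u) → LastIs p (h ∷ v) → length u + length v < g → u ≡ v
    NBWalkʳ-unique {u = []}    {[]}    _  _  _  _  _  = refl
    NBWalkʳ-unique {u = []}    {_ ∷ _} _  wv last pv lt = ⊥-elim $
      noShortClosedNBWalkʳ wv pv (s≤s z≤n) lt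
    NBWalkʳ-unique {u = _ ∷ _} {[]}    wu _  pu last lt = ⊥-elim $
      noShortClosedNBWalkʳ wu pu (s≤s z≤n) (subst (_< g) (+-identityʳ _) lt)
    NBWalkʳ-unique {h} {x ∷ u} {y ∷ v} wu wv (_ ∷ pu) pv@(_ ∷ pv′) lt with x ≟ y
    ... | yes refl = cong (x ∷_)
      (NBWalkʳ-unique (NBWalkʳ-tail wu) (NBWalkʳ-tail wv) pu pv′
        (≤-<-trans (+-mono-≤ (n≤1+n _) (n≤1+n _)) lt))
    -- Where the walks first differ, going out along one and back along the other is a closed
    -- non-backtracking walk at p.
    ... | no x≢y with ʳ++-head (h ∷ y ∷ v) pu
    ...   | ys , eq = ⊥-elim $ noShortClosedNBWalkʳ
      (subst NBWalkʳ eq (ʳ++-NBWalkʳ wu x≢y wv)) (subst (LastIs p) eq (ʳ++-LastIs (x ∷ u) pv))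
      (subst (0 <_) (sym length-ys) (s≤s z≤n)) (subst (_< g) (sym length-ys) lt)
      where
        length-ys : length ys ≡ length (x ∷ u) + length (y ∷ v)
        length-ys = suc-injective (begin
          suc (length ys)                         ≡⟨ cong length eq ⟨
          length ((x ∷ u) ʳ++ (h ∷ y ∷ v))        ≡⟨ length-ʳ++ (x ∷ u) ⟩
          length (x ∷ u) + suc (length (y ∷ v))   ≡⟨ +-suc (length (x ∷ u)) (length (y ∷ v)) ⟩
          suc (length (x ∷ u) + length (y ∷ v))   ∎)
          where open ≡-Reasoning

module _ (Γ : Geometry) where
  open Geometry Γ

  _≟ᴱ_ : DecidableEquality (Elem Γ)
  _≟ᴱ_ = Sum.≡-dec Fin._≟_ Fin._≟_

  I-sym : ∀ {x y} → _I_ Γ x y → _I_ Γ y x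
  I-sym {inj₁ _} {inj₂ _} xIy = xIy
  I-sym {inj₂ _} {inj₁ _} xIy = xIy

  isPoint : Elem Γ → Bool
  isPoint (inj₁ _) = true
  isPoint (inj₂ _) = false

  I⇒isPoint-flips : ∀ {x y} → _I_ Γ x y → isPoint y ≡ not (isPoint x)
  I⇒isPoint-flips {inj₁ _} {inj₂ _} _ = refl
  I⇒isPoint-flips {inj₂ _} {inj₁ _} _ = refl

  open Walks (_I_ Γ) I-sym

  injectiveClosedNBWalk⇒ordinaryGon : ∀ {w l} → IsNBWalk w l → 0 < l → w l ≡ w 0 →
    InjectiveBelow w l → ∃[ k ] (2 ≤ k × k + k ≡ l × HasOrdinaryGon Γ k)
  injectiveClosedNBWalk⇒ordinaryGon {w} {l} (walk , nb) 0<l closed inj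
    with alternating-return⇒even (isPoint ∘ w) l (λ i i<l → I⇒isPoint-flips (walk i i<l))
                                 (cong isPoint closed)
  ... | zero , refl = contradiction 0<l (<-irrefl refl)
  ... | suc zero , refl = contradiction (sym closed) (nb 0 ≤-refl)
  ... | suc (suc k) , refl = suc (suc k) , s≤s (s≤s z≤n) , refl , w , walk , closed , inj

  closedNBWalk⇒ordinaryGon : ∀ {w l} → IsNBWalk w l → 0 < l → w l ≡ w 0 →
    ∃[ k ] (2 ≤ k × k + k ≤ l × HasOrdinaryGon Γ k)
  closedNBWalk⇒ordinaryGon {w} {l} nbw 0<l closed with firstRepetition _≟ᴱ_ w (suc l)
  ... | inj₁ inj = contradiction (inj l 0 ≤-refl (s≤s z≤n) closed) (m<n⇒n≢0 0<l)
  ... | inj₂ (i , j , i<j , j≤l , wi≡wj , inj) with m≤n⇒∃[o]m+o≡n (<⇒≤ i<j)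
  ...   | d , refl with injectiveClosedNBWalk⇒ordinaryGon
                          (IsNBWalk-drop i (IsNBWalk-≤ (≤-pred j≤l) nbw))
                          (+-cancelˡ-< i 0 d (subst (_< i + d) (sym (+-identityʳ i)) i<j))
                          (trans (sym wi≡wj) (cong w (sym (+-identityʳ i))))
                          (InjectiveBelow-drop i inj)
  ...     | k , 2≤k , refl , gon = k , 2≤k , m+n≤o⇒n≤o i (≤-pred j≤l) , gon

  module _ {n : ℕ} (noSmallGon : ∀ k → 2 ≤ k → k < n → ¬ HasOrdinaryGon Γ k) where

    noShortClosedNBWalk : ∀ {w l} → IsNBWalk w l → 0 < l → l < n + n → w l ≡ w 0 → ⊥
    noShortClosedNBWalk nbw 0<l l<2n closed with closedNBWalk⇒ordinaryGon nbw 0<l closed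
    ... | k , 2≤k , 2k≤l , gon = noSmallGon k 2≤k k<n gon
      where
        k<n : k < n
        k<n = ≰⇒> λ n≤k → <⇒≱ (≤-<-trans 2k≤l l<2n) (+-mono-≤ n≤k n≤k)

  module _ {s t : ℕ} (order : HasOrder Γ s t) where
    open HasOrder order

    lineCount-upperBound : (B : Subset np) → Blocks Γ B → nl ≤ ∣ B ∣ * suc t
    lineCount-upperBound B blocks = begin
      nl                                      ≡⟨ length-tabulate id ⟨
      length (allFin nl)                      ≤⟨ Unique-⊆⇒length≤ (Unique.allFin⁺ nl) covered ⟩
      length (concatMap linesOn (elements B)) ≡⟨ length-concatMap-uniform linesOn (elements B)
                                                   (All.universal length-linesOn _) ⟩
      length (elements B) * suc t             ≡⟨ cong (_* suc t) (length-elements B) ⟩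
      ∣ B ∣ * suc t                           ∎
      where
        open ≤-Reasoning
        linesOn : Fin np → List (Fin nl)
        linesOn p = elements (linesThrough Γ p)
        length-linesOn : ∀ p → length (linesOn p) ≡ suc t
        length-linesOn p = trans (length-elements (linesThrough Γ p)) (pointDeg p)
        covered : allFin nl ⊆ concatMap linesOn (elements B)
        covered {L} _ with blocks L
        ... | p , p∈B , pIL =
          ∈-concatMap⁺ linesOn (lose (∈-elements⁺ p∈B) (∈-elements⁺ (∈-tabulate⁺ pIL)))

    neighbours : Elem Γ → List (Elem Γ)
    neighbours (inj₁ p) = map inj₂ (elements (linesThrough Γ p))
    neighbours (inj₂ L) = map inj₁ (elements (pointsOn Γ L))

    ∈-neighbours⁺ : ∀ {x y} → _I_ Γ x y → y ∈ neighbours x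
    ∈-neighbours⁺ {inj₁ _} {inj₂ _} pIL = ∈-map⁺ inj₂ (∈-elements⁺ (∈-tabulate⁺ pIL))
    ∈-neighbours⁺ {inj₂ _} {inj₁ _} pIL = ∈-map⁺ inj₁ (∈-elements⁺ (∈-tabulate⁺ pIL))

    ∈-neighbours⁻ : ∀ {x y} → y ∈ neighbours x → _I_ Γ x y
    ∈-neighbours⁻ {inj₁ _} y∈ with ∈-map⁻ inj₂ y∈
    ... | _ , L∈ , refl = ∈-tabulate⁻ (∈-elements⁻ L∈)
    ∈-neighbours⁻ {inj₂ _} y∈ with ∈-map⁻ inj₁ y∈
    ... | _ , p∈ , refl = ∈-tabulate⁻ (∈-elements⁻ p∈)

    Unique-neighbours : ∀ x → Unique (neighbours x)
    Unique-neighbours (inj₁ p) = Unique.map⁺ Sum.inj₂-injective (Unique-elements (linesThrough Γ p))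
    Unique-neighbours (inj₂ L) = Unique.map⁺ Sum.inj₁-injective (Unique-elements (pointsOn Γ L))

    degree : Elem Γ → ℕ
    degree (inj₁ _) = t
    degree (inj₂ _) = s

    length-neighbours : ∀ x → length (neighbours x) ≡ suc (degree x)
    length-neighbours (inj₁ p) = trans (length-map inj₂ (elements (linesThrough Γ p)))
                                       (trans (length-elements (linesThrough Γ p)) (pointDeg p))
    length-neighbours (inj₂ L) = trans (length-map inj₁ (elements (pointsOn Γ L)))
                                       (trans (length-elements (pointsOn Γ L)) (lineSize L))

    extensions : List (Elem Γ) → List (List (Elem Γ))
    extensions []           = []
    extensions (y ∷ [])     = map (_∷ [ y ]) (neighbours y)
    extensions (y ∷ x ∷ ws) = map (_∷ y ∷ x ∷ ws) (filter (¬? ∘ (_≟ᴱ x)) (neighbours y))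

    ∈-extensions⁻ : ∀ {y ws v} → v ∈ extensions (y ∷ ws) →
      ∃[ z ] (v ≡ z ∷ y ∷ ws × _I_ Γ z y × z ≢head ws)
    ∈-extensions⁻ {ws = []} v∈ with ∈-map⁻ (_∷ _) v∈
    ... | z , z∈ , refl = z , refl , I-sym (∈-neighbours⁻ z∈) , _
    ∈-extensions⁻ {ws = x ∷ _} v∈ with ∈-map⁻ (_∷ _) v∈
    ... | z , z∈ , refl with ∈-filter⁻ (¬? ∘ (_≟ᴱ x)) z∈
    ...   | z∈′ , z≢x = z , refl , I-sym (∈-neighbours⁻ z∈′) , z≢x

    Unique-extensions : ∀ w → Unique (extensions w)
    Unique-extensions []           = []
    Unique-extensions (y ∷ [])     = Unique.map⁺ ∷-injectiveˡ (Unique-neighbours y)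
    Unique-extensions (y ∷ x ∷ ws) =
      Unique.map⁺ ∷-injectiveˡ (Unique.filter⁺ _ (Unique-neighbours y))

    length-extensions : ∀ {y x ws} → NBWalkʳ (y ∷ x ∷ ws) →
      length (extensions (y ∷ x ∷ ws)) ≡ degree y
    length-extensions {y} (step yIx _ _) = trans (length-map _ (filter _ (neighbours y)))
      (suc-injective (trans (length-filter-≢ _≟ᴱ_ (Unique-neighbours y) (∈-neighbours⁺ yIx))
                            (length-neighbours y)))

    twoSteps : List (Elem Γ) → List (List (Elem Γ))
    twoSteps = concatMap extensions ∘ extensions

    extensions-drop : ∀ w {v} → v ∈ extensions w → drop 1 v ≡ w
    extensions-drop (_ ∷ _) v∈ with ∈-extensions⁻ v∈
    ... | _ , v≡z∷w , _ = cong (drop 1) v≡z∷w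

    Unique-twoSteps : ∀ w → Unique (twoSteps w)
    Unique-twoSteps w =
      Unique-concatMap extensions (drop 1) extensions-drop Unique-extensions (Unique-extensions w)

    twoSteps-drop : ∀ w {v} → v ∈ twoSteps w → drop 2 v ≡ w
    twoSteps-drop w {v} v∈ with find (∈-concatMap⁻ extensions {xs = extensions w} v∈)
    ... | u , u∈ , v∈u = begin
      drop 2 v          ≡⟨ drop-drop 1 1 v ⟨
      drop 1 (drop 1 v) ≡⟨ cong (drop 1) (extensions-drop u v∈u) ⟩
      drop 1 u          ≡⟨ extensions-drop w u∈ ⟩
      w                 ∎
      where open ≡-Reasoning

    length-twoSteps : ∀ {L x ws} → NBWalkʳ (inj₂ L ∷ x ∷ ws) →
      length (twoSteps (inj₂ L ∷ x ∷ ws)) ≡ s * t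
    length-twoSteps {L} {x} {ws} w = trans
      (length-concatMap-uniform extensions _ (All.tabulate λ u∈ → length-extensions-at-point u∈))
      (cong (_* t) (length-extensions w))
      where
        length-extensions-at-point : ∀ {u} → u ∈ extensions (inj₂ L ∷ x ∷ ws) →
          length (extensions u) ≡ t
        length-extensions-at-point u∈ with ∈-extensions⁻ {inj₂ L} {x ∷ ws} u∈
        ... | inj₂ _ , _    , ()  , _
        ... | inj₁ _ , refl , pIL , p≢x = length-extensions (step pIL p≢x w)

    module _ (p₀ : Fin np) where

      data LineWalk (i : ℕ) : List (Elem Γ) → Set where
        lineWalk : ∀ {L ws} → NBWalkʳ (inj₂ L ∷ ws) → LastIs (inj₁ p₀) (inj₂ L ∷ ws) →
                   length ws ≡ suc (i + i) → LineWalk i (inj₂ L ∷ ws)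

      twoSteps-LineWalk : ∀ {i w v} → LineWalk i w → v ∈ twoSteps w → LineWalk (suc i) v
      twoSteps-LineWalk {i} {w} (lineWalk {L} {ws} nbw from len) v∈
        with find (∈-concatMap⁻ extensions {xs = extensions w} v∈)
      ... | u , u∈ , v∈u with ∈-extensions⁻ {inj₂ L} {ws} u∈
      ... | inj₂ _ , _    , () , _
      ... | inj₁ p , refl , pIL , p≢ with ∈-extensions⁻ {inj₁ p} {inj₂ L ∷ ws} v∈u
      ...   | inj₁ _  , _    , ()   , _
      ...   | inj₂ L′ , refl , L′Ip , L′≢L =
        lineWalk (step L′Ip L′≢L (step pIL p≢ nbw)) (_ ∷ _ ∷ from)
          (cong (2 +_) (trans len (sym (+-suc i i))))

      lineWalks : ℕ → List (List (Elem Γ))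
      lineWalks zero    = extensions [ inj₁ p₀ ]
      lineWalks (suc i) = concatMap twoSteps (lineWalks i)

      lineWalks-LineWalk : ∀ i → All (LineWalk i) (lineWalks i)
      lineWalks-LineWalk zero    = All.tabulate first
        where
          first : ∀ {v} → v ∈ extensions [ inj₁ p₀ ] → LineWalk 0 v
          first v∈ with ∈-extensions⁻ {inj₁ p₀} {[]} v∈
          ... | inj₁ _ , _    , ()  , _
          ... | inj₂ _ , refl , LIp , _ = lineWalk (step LIp _ (start _)) (_ ∷ last) refl
      lineWalks-LineWalk (suc i) =
        AllP.concat⁺ (AllP.map⁺ (All.map (λ lw → All.tabulate (twoSteps-LineWalk lw)) (lineWalks-LineWalk i)))

      Unique-lineWalks : ∀ i → Unique (lineWalks i)
      Unique-lineWalks zero    = Unique-extensions [ inj₁ p₀ ]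
      Unique-lineWalks (suc i) =
        Unique-concatMap twoSteps (drop 2) twoSteps-drop Unique-twoSteps (Unique-lineWalks i)

      length-twoSteps-LineWalk : ∀ {i w} → LineWalk i w → length (twoSteps w) ≡ s * t
      length-twoSteps-LineWalk (lineWalk {ws = _ ∷ _} nbw _ _) = length-twoSteps nbw

      length-lineWalks : ∀ i → length (lineWalks i) ≡ suc t * (s * t) ^ i
      length-lineWalks zero = trans (length-map _ (neighbours (inj₁ p₀)))
                                    (trans (length-neighbours (inj₁ p₀)) (sym (*-identityʳ (suc t))))
      length-lineWalks (suc i) = begin
        length (concatMap twoSteps (lineWalks i))
          ≡⟨ length-concatMap-uniform twoSteps _
               (All.map length-twoSteps-LineWalk (lineWalks-LineWalk i)) ⟩
        length (lineWalks i) * (s * t)    ≡⟨ cong (_* (s * t)) (length-lineWalks i) ⟩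
        suc t * (s * t) ^ i * (s * t)     ≡⟨ *-assoc (suc t) ((s * t) ^ i) (s * t) ⟩
        suc t * ((s * t) ^ i * (s * t))   ≡⟨ cong (suc t *_) (*-comm ((s * t) ^ i) (s * t)) ⟩
        suc t * (s * t) ^ suc i           ∎
        where open ≡-Reasoning

      LineWalk-index : ∀ {i j w} → LineWalk i w → LineWalk j w → i + i ≡ j + j
      LineWalk-index (lineWalk _ _ lenᵢ) (lineWalk _ _ lenⱼ) = suc-injective (trans (sym lenᵢ) lenⱼ)

      lineWalksBelow : ℕ → List (List (Elem Γ))
      lineWalksBelow zero    = []
      lineWalksBelow (suc m) = lineWalks m ++ lineWalksBelow m

      ∈-lineWalksBelow⁻ : ∀ m {w} → w ∈ lineWalksBelow m → ∃[ i ] (i < m × LineWalk i w)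
      ∈-lineWalksBelow⁻ (suc m) w∈ with ∈-++⁻ (lineWalks m) w∈
      ... | inj₁ w∈ₘ = m , ≤-refl , All.lookup (lineWalks-LineWalk m) w∈ₘ
      ... | inj₂ w∈< with ∈-lineWalksBelow⁻ m w∈<
      ...   | i , i<m , lw = i , m<n⇒m<1+n i<m , lw

      Unique-lineWalksBelow : ∀ m → Unique (lineWalksBelow m)
      Unique-lineWalksBelow zero    = []
      Unique-lineWalksBelow (suc m) = Unique.++⁺ (Unique-lineWalks m) (Unique-lineWalksBelow m) disjoint
        where
          disjoint : ∀ {w} → ¬ (w ∈ lineWalks m × w ∈ lineWalksBelow m)
          disjoint (w∈ₘ , w∈<) with ∈-lineWalksBelow⁻ m w∈<
          ... | i , i<m , lwᵢ =
            <⇒≢ (+-mono-< i<m i<m) (LineWalk-index lwᵢ (All.lookup (lineWalks-LineWalk m) w∈ₘ))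

      length-lineWalksBelow : ∀ m → length (lineWalksBelow m) ≡ suc t * geometricSum (s * t) m
      length-lineWalksBelow zero    = sym (*-zeroʳ (suc t))
      length-lineWalksBelow (suc m) = trans (length-++ (lineWalks m))
        (trans (cong₂ _+_ (length-lineWalks m) (length-lineWalksBelow m))
               (sym (*-distribˡ-+ (suc t) ((s * t) ^ m) (geometricSum (s * t) m))))

      module _ {m : ℕ} (noSmallGon : ∀ k → 2 ≤ k → k < m + m → ¬ HasOrdinaryGon Γ k) where

        LineWalk-head-injective : ∀ {i j u v} → i < m → j < m → LineWalk i u → LineWalk j v →
          head u ≡ head v → u ≡ v
        LineWalk-head-injective {i} {j} i<m j<m (lineWalk nbu pu lenu) (lineWalk nbv pv lenv) refl =
          cong (_ ∷_) (NBWalkʳ-unique _≟ᴱ_ (noShortClosedNBWalk noSmallGon) nbu nbv pu pv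
            (subst₂ (λ a b → a + b < (m + m) + (m + m)) (sym lenu) (sym lenv)
              (+-mono-< (suc[i+i]<m+m i<m) (suc[i+i]<m+m j<m))))
          where
            suc[i+i]<m+m : ∀ {i} → i < m → suc (i + i) < m + m
            suc[i+i]<m+m {i} i<m = subst (_≤ m + m) (cong suc (+-suc i i)) (+-mono-≤ i<m i<m)

        lineCount-lowerBound : suc t * geometricSum (s * t) m ≤ nl
        lineCount-lowerBound = begin
          suc t * geometricSum (s * t) m           ≡⟨ length-lineWalksBelow m ⟨
          length (lineWalksBelow m)                ≡⟨ length-map head (lineWalksBelow m) ⟨
          length (map head (lineWalksBelow m))     ≤⟨ Unique-⊆⇒length≤ Unique-endpoints endpoints⊆lines ⟩
          length (map (just ∘ inj₂) (allFin nl))   ≡⟨ length-map (just ∘ inj₂) (allFin nl) ⟩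
          length (allFin nl)                       ≡⟨ length-tabulate id ⟩
          nl                                       ∎
          where
            open ≤-Reasoning
            Unique-endpoints : Unique (map head (lineWalksBelow m))
            Unique-endpoints = Unique-map⁺-injectiveOn
              (λ (i , i<m , lwᵢ) (j , j<m , lwⱼ) → LineWalk-head-injective i<m j<m lwᵢ lwⱼ)
              (All.tabulate (∈-lineWalksBelow⁻ m)) (Unique-lineWalksBelow m)
            endpoints⊆lines : map head (lineWalksBelow m) ⊆ map (just ∘ inj₂) (allFin nl)
            endpoints⊆lines e∈ with ∈-map⁻ head e∈
            ... | w , w∈ , refl with ∈-lineWalksBelow⁻ m w∈
            ...   | _ , _ , lineWalk {L} _ _ _ = ∈-map⁺ (just ∘ inj₂) (∈-allFin L)

lemma2p8 : (Γ : Geometry) (m s t : ℕ) → 2 ≤ m →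
    IsWeakGenPolygon Γ (m + m) → HasOrder Γ s t →
    (B : Subset (Geometry.np Γ)) → Blocks Γ B →
    (s * t) ^ m ∸ 1 ≤ ∣ B ∣ * (s * t ∸ 1)
lemma2p8 Γ m s t _ polygon order B blocks =
  geometricSum≤⇒^∸1≤ (s * t) m ∣ B ∣ (*-mono-≤ s≥1 t≥1) (*-cancelˡ-≤ (suc t) (begin
    suc t * geometricSum (s * t) m ≤⟨ lineCount-lowerBound Γ order (fromℕ< nonempty) {m} noSmallGon ⟩
    Geometry.nl Γ                  ≤⟨ lineCount-upperBound Γ order B blocks ⟩
    ∣ B ∣ * suc t                  ≡⟨ *-comm ∣ B ∣ (suc t) ⟩
    suc t * ∣ B ∣                  ∎))
  where
    open IsWeakGenPolygon polygon
    open HasOrder order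
    open ≤-Reasoning
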